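{- Let $L$ be a finite set of integers and $x<\min(L)$ an integer. Then $\Psi$ is a bijection between plane alternative forests labeled by $L$ and permutations $w$ with $supp(w)=L\cup\{x\}$. Moreover, if $\sigma=\Psi(F)$ and $i\in L$, then $i$ labels: - a white root of $F$ if and only if $i$ is an RL-minimum of $\sigma$; - a black root of $F$ if and only if $i$ is a shifted RL-maximum of $\sigma$; - a white vertex of $F$ if and only if $i$ is an ascent of $\sigma$; - a black vertex of $F$ if and only if $i$ is a descent of $\sigma$.
   Context: A vertex of a labeled rooted tree is minimal (maximal) if its label is smaller (larger) than the labels of all its descendants. A plane alternative tree is a rooted plane tree with pairwise distinct integer labels and black/white vertices such that: - every white vertex is minimal, and its children are black with labels decreasing from left to right; - every black vertex is maximal, and its children are white with labels increasing from left to right. A plane alternative forest is a set of plane alternative trees with pairwise disjoint label sets; its label set is the union of these. A permutation is a finite word over the integers with no repeated letter; $supp(w)$ is its set of letters. - An RL-minimum (RL-maximum) of $w$ is a letter smaller (larger) than all letters to its right. - If $w=w_1mw_2$ with $m=\min supp(w)$, a shifted RL-maximum of $w$ is an RL-maximum of the word $w_1$. - An ascent is a letter smaller than the next letter; the last letter is also an ascent by convention. - A descent is a letter larger than the next letter. For a plane alternative tree $T$, $\psi(T)=m$ if $T$ is a single vertex labeled $m$. Otherwise $\psi(T)=\psi(T_1)\cdots\psi(T_k)\,m$, where $m$ is the root label and $T_1,\dots,T_k$ are the root subtrees from left to right. For a forest $F$ labeled by $L$, let $T_1,\dots,T_i$ be its white-rooted trees in increasing order of root labels and $T'_1,\dots,T'_j$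 its black-rooted trees in decreasing order of root labels. Then $\Psi(F)=\psi(T'_1)\cdots\psi(T'_j)\,x\,\psi(T_1)\cdots\psi(T_i)$. -}

module Defs where

open import Data.Integer using (ℤ; _<_; _≤_; _>_; _≤?_)
open import Data.List using (List; []; _∷_; _++_; [_])
open import Data.List.Relation.Unary.All using (All)
open import Data.List.Relation.Unary.Any using (Any)
open import Data.List.Relation.Unary.Linked using (Linked)
open import Data.List.Relation.Unary.Unique.Propositional using (Unique)
open import Data.List.Membership.Propositional using (_∈_)
open import Data.Product using (Σ; ∃; ∃-syntax; _×_; _,_)
open import Data.Sum using (_⊎_)
open import Data.Unit using (⊤)
open import Relation.Nullary using (yes; no)
open import Relation.Binary.PropositionalEquality using (_≡_)
open import Function.Bundles using (_⇔_)

data Colour : Set where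
  white black : Colour

-- node c m ts : root of colour c, label m, root subtrees ts (left to right)
data Tree : Set where
  node : Colour → ℤ → List Tree → Tree

colour : Tree → Colour
colour (node c _ _) = c

rootLabel : Tree → ℤ
rootLabel (node _ m _) = m

mutual
  labelsT : Tree → List ℤ
  labelsT (node _ m ts) = m ∷ labelsF ts

  labelsF : List Tree → List ℤ
  labelsF []       = []
  labelsF (t ∷ ts) = labelsT t ++ labelsF ts

mutual
  verticesT : Tree → List (Colour × ℤ)
  verticesT (node c m ts) = (c , m) ∷ verticesF ts

  verticesF : List Tree → List (Colour × ℤ)
  verticesF []       = []
  verticesF (t ∷ ts) = verticesT t ++ verticesF ts

rootLabels : List Tree → List ℤ
rootLabels []       = []
rootLabels (t ∷ ts) = rootLabel t ∷ rootLabels ts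

-- Local alternative-tree conditions (labels of descendants = labelsF ts)
mutual
  AltT : Tree → Set
  AltT (node white m ts) =
    All (λ d → m < d) (labelsF ts)
    × All (λ t → colour t ≡ black) ts
    × Linked _>_ (rootLabels ts)
    × AltF ts
  AltT (node black m ts) =
    All (λ d → d < m) (labelsF ts)
    × All (λ t → colour t ≡ white) ts
    × Linked _<_ (rootLabels ts)
    × AltF ts

  AltF : List Tree → Set
  AltF []       = ⊤
  AltF (t ∷ ts) = AltT t × AltF ts

-- A forest is a *set* of trees; it is represented by a list, and two
-- lists represent the same forest iff they are permutations of each other.
PAForest : List ℤ → List Tree → Set
PAForest L F = AltF F × Unique (labelsF F) × (∀ i → (i ∈ labelsF F ⇔ i ∈ L))

mutual
  ψ : Tree → List ℤ
  ψ (node _ m ts) = ψs ts ++ [ m ]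

  ψs : List Tree → List ℤ
  ψs []       = []
  ψs (t ∷ ts) = ψ t ++ ψs ts

whiteRooted : List Tree → List Tree
whiteRooted [] = []
whiteRooted (node white m ts ∷ F) = node white m ts ∷ whiteRooted F
whiteRooted (node black m ts ∷ F) = whiteRooted F

blackRooted : List Tree → List Tree
blackRooted [] = []
blackRooted (node white m ts ∷ F) = blackRooted F
blackRooted (node black m ts ∷ F) = node black m ts ∷ blackRooted F

insertInc : Tree → List Tree → List Tree
insertInc t [] = [ t ]
insertInc t (u ∷ us) with rootLabel t ≤? rootLabel u
... | yes _ = t ∷ u ∷ us
... | no  _ = u ∷ insertInc t us

sortInc : List Tree → List Tree
sortInc []       = []
sortInc (t ∷ ts) = insertInc t (sortInc ts)

insertDec : Tree → List Tree → List Tree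
insertDec t [] = [ t ]
insertDec t (u ∷ us) with rootLabel u ≤? rootLabel t
... | yes _ = t ∷ u ∷ us
... | no  _ = u ∷ insertDec t us

sortDec : List Tree → List Tree
sortDec []       = []
sortDec (t ∷ ts) = insertDec t (sortDec ts)

Ψ : ℤ → List Tree → List ℤ
Ψ x F = ψs (sortDec (blackRooted F)) ++ x ∷ ψs (sortInc (whiteRooted F))

PermOn : ℤ → List ℤ → List ℤ → Set
PermOn x L w = Unique w × (∀ i → (i ∈ w ⇔ (i ≡ x ⊎ i ∈ L)))

RLMin : List ℤ → ℤ → Set
RLMin w i = ∃[ u ] ∃[ v ] (w ≡ u ++ i ∷ v × All (λ j → i < j) v)

RLMax : List ℤ → ℤ → Set
RLMax w i = ∃[ u ] ∃[ v ] (w ≡ u ++ i ∷ v × All (λ j → j < i) v)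

ShiftedRLMax : List ℤ → ℤ → Set
ShiftedRLMax w i =
  ∃[ w₁ ] ∃[ m ] ∃[ w₂ ] (w ≡ w₁ ++ m ∷ w₂ × All (λ j → m ≤ j) w × RLMax w₁ i)

Ascent : List ℤ → ℤ → Set
Ascent w i = ∃[ u ] ∃[ v ]
  (w ≡ u ++ i ∷ v × (v ≡ [] ⊎ ∃[ j ] ∃[ v' ] (v ≡ j ∷ v' × i < j)))

Descent : List ℤ → ℤ → Set
Descent w i = ∃[ u ] ∃[ j ] ∃[ v ] (w ≡ u ++ i ∷ j ∷ v × j < i)

WhiteRoot : List Tree → ℤ → Set
WhiteRoot F i = Any (λ t → colour t ≡ white × rootLabel t ≡ i) F

BlackRoot : List Tree → ℤ → Set
BlackRoot F i = Any (λ t → colour t ≡ black × rootLabel t ≡ i) F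

WhiteVertex : List Tree → ℤ → Set
WhiteVertex F i = (white , i) ∈ verticesF F

BlackVertex : List Tree → ℤ → Set
BlackVertex F i = (black , i) ∈ verticesF F

module Submission where

-- Both colours are treated at once by orienting ℤ by a colour: a <[ c ] b is
-- a < b for white and a > b for black.  The central notion is a c-chain: a list
-- of c-rooted trees whose every root is c-before all labels of its own subtrees
-- and of the later trees, the subtrees forming an (opp c)-chain.  We prove that
-- ψs is a bijection from c-chains onto repetition-free words (ψs-injective, and
-- decompose, which cuts a word at its c-extremal letter), that a chain is
-- determined by its set of trees (chain-rigid), and that in the word of a chain
-- the roots are the RL-extrema (chain-roots) and the vertices of each colour the
-- ascents resp. descents (chain-turns).  Sorting the colour classes of an
-- alternative forest F gives a black chain B and a white chain W with
-- Ψ x F = ψs B ++ x ∷ ψs W (arrange-chain, Ψ-arrange), and every such pair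
-- arises this way (arrange-join).  Since x is the unique minimum of that word,
-- the five parts of the proposition follow (Ψ-permutation … Ψ-statistics).

open import Defs
open import Data.Integer using (ℤ; _<_; _≤_; _≤?_)
import Data.Integer.Properties as ℤ
open import Data.List using (List; []; _∷_; _++_; [_]; length; filter; map; concatMap)
open import Data.List.Properties
  using (++-assoc; ++-identityʳ; ∷-injective; length-++; map-++; concatMap-++; filter-all; filter-none; filter-++)
import Data.Nat as ℕ using (suc; _<_; s≤s; z≤n)
import Data.Nat.Properties as ℕ using (m<m+n; m≤n+m)
open import Data.Nat.Induction using (<-wellFounded)
open import Induction.WellFounded using (Acc; acc)
open import Relation.Binary.Construct.On using () renaming (wellFounded to on-wellFounded)
open import Data.List.Relation.Unary.All as All using (All; []; _∷_)
import Data.List.Relation.Unary.All.Properties as All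
open import Data.List.Relation.Unary.Any using (Any; here; there)
import Data.List.Relation.Unary.Any.Properties as Any
open import Data.List.Relation.Unary.Linked as Linked using (Linked; []; [-]; _∷_)
open import Data.List.Relation.Unary.Linked.Properties using (Linked⇒All)
open import Data.List.Relation.Unary.Unique.Propositional using (Unique; []; _∷_)
open import Data.List.Membership.Propositional using (_∈_; _∉_)
open import Data.List.Membership.Propositional.Properties using (∈-++⁺ˡ; ∈-++⁺ʳ; ∈-++⁻; ∈-map⁻; ∈-∃++)
import Data.List.Relation.Binary.Permutation.Propositional as Perm
open import Data.List.Relation.Binary.Permutation.Propositional
  using (_↭_; ↭-refl; ↭-sym; ↭-trans; ↭-prep; ↭-swap; ↭-reflexive; ↭⇒↭ₛ)
open import Data.List.Relation.Binary.Permutation.Propositional.Properties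
  using ( ∈-resp-↭; All-resp-↭; Any-resp-↭; shift; shifts; ++⁺; ++⁺ˡ; ++-comm; drop-∷
        ; ¬x∷xs↭[]; filter-↭)
import Data.List.Relation.Binary.Permutation.Setoid.Properties as Permₛ
open import Data.Product using (∃-syntax; _×_; _,_; proj₁; proj₂)
open import Data.Sum using (_⊎_; inj₁; inj₂; [_,_]′)
open import Data.Empty using (⊥; ⊥-elim)
open import Relation.Nullary using (¬_; Dec; yes; no)
open import Function.Bundles using (_⇔_; mk⇔; Equivalence)
open import Function.Construct.Composition using (_⇔-∘_)
open import Function.Construct.Symmetry using (⇔-sym)
open import Function.Construct.Identity using (⇔-id)
open import Function.Properties.Inverse using (↔⇒⇔)
open import Data.Sum.Function.Propositional using (_⊎-⇔_)
open import Relation.Binary.PropositionalEquality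
  using (_≡_; _≢_; refl; sym; trans; cong; cong₂; subst; subst₂; setoid; module ≡-Reasoning)

private
  variable
    A A′ : Set

-- A white vertex is smaller than its descendants and a
-- black one larger, so each colour c orients ℤ: a <[ c ] b means that a
-- may sit above b in a c-coloured vertex (< for white, > for black).

opp : Colour → Colour
opp white = black
opp black = white

_<[_]_ : ℤ → Colour → ℤ → Set
a <[ white ] b = a < b
a <[ black ] b = b < a

_≤[_]_ : ℤ → Colour → ℤ → Set
a ≤[ white ] b = a ≤ b
a ≤[ black ] b = b ≤ a

-- These decisions are literally the comparisons made by insertInc/insertDec.
_≤?[_]_ : ∀ a c b → Dec (a ≤[ c ] b)
a ≤?[ white ] b = a ≤? b
a ≤?[ black ] b = b ≤? a

<[]-irrefl : ∀ c {a} → ¬ a <[ c ] a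
<[]-irrefl white = ℤ.<-irrefl refl
<[]-irrefl black = ℤ.<-irrefl refl

<[]-asym : ∀ c {a b} → a <[ c ] b → ¬ b <[ c ] a
<[]-asym white = ℤ.<-asym
<[]-asym black = ℤ.<-asym

<[]⇒≤[] : ∀ c {a b} → a <[ c ] b → a ≤[ c ] b
<[]⇒≤[] white = ℤ.<⇒≤
<[]⇒≤[] black = ℤ.<⇒≤

≤[]-refl : ∀ c {a} → a ≤[ c ] a
≤[]-refl white = ℤ.≤-refl
≤[]-refl black = ℤ.≤-refl

≤[]-trans : ∀ c {a b d} → a ≤[ c ] b → b ≤[ c ] d → a ≤[ c ] d
≤[]-trans white p q = ℤ.≤-trans p q
≤[]-trans black p q = ℤ.≤-trans q p

≤[]-antisym : ∀ c {a b} → a ≤[ c ] b → b ≤[ c ] a → a ≡ b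
≤[]-antisym white p q = ℤ.≤-antisym p q
≤[]-antisym black p q = ℤ.≤-antisym q p

≤[]∧≢⇒<[] : ∀ c {a b} → a ≤[ c ] b → a ≢ b → a <[ c ] b
≤[]∧≢⇒<[] white p ne = ℤ.≤∧≢⇒< p ne
≤[]∧≢⇒<[] black p ne = ℤ.≤∧≢⇒< p (λ e → ne (sym e))

≰[]⇒>[] : ∀ c {a b} → ¬ a ≤[ c ] b → b <[ c ] a
≰[]⇒>[] white = ℤ.≰⇒>
≰[]⇒>[] black = ℤ.≰⇒>

<[]-opp : ∀ c {a b} → a <[ c ] b → b <[ opp c ] a
<[]-opp white p = p
<[]-opp black p = p

_≟ᶜ_ : (c d : Colour) → Dec (c ≡ d)
white ≟ᶜ white = yes refl
white ≟ᶜ black = no (λ ())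
black ≟ᶜ white = no (λ ())
black ≟ᶜ black = yes refl

opp-≢ : ∀ c → opp c ≢ c
opp-≢ white ()
opp-≢ black ()

other-colour : ∀ {c d} → d ≢ c → d ≡ opp c
other-colour {white} {white} d≢c = ⊥-elim (d≢c refl)
other-colour {white} {black} _   = refl
other-colour {black} {white} _   = refl
other-colour {black} {black} d≢c = ⊥-elim (d≢c refl)

data Position (a : List A) (m : A) (b u : List A) (i : A) (v : List A) : Set where
  before : ∀ s → a ≡ u ++ i ∷ s → v ≡ s ++ m ∷ b → Position a m b u i v
  at     : i ≡ m → u ≡ a → v ≡ b → Position a m b u i v
  after  : ∀ s → b ≡ s ++ i ∷ v → u ≡ a ++ m ∷ s → Position a m b u i v

position : ∀ (a : List A) {m b u i v} → a ++ m ∷ b ≡ u ++ i ∷ v → Position a m b u i v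
position []      {u = []}    refl = at refl refl refl
position []      {u = _ ∷ u} eq with ∷-injective eq
... | refl , refl = after u refl refl
position (_ ∷ a) {u = []}    eq with ∷-injective eq
... | refl , refl = before a refl refl
position (_ ∷ a) {u = _ ∷ u} eq with ∷-injective eq
... | refl , eq′ with position a eq′
...   | before s refl refl = before s refl refl
...   | at refl refl refl  = at refl refl refl
...   | after s refl refl  = after s refl refl

∈-mid : ∀ (u : List A) {i v} → i ∈ u ++ i ∷ v
∈-mid u = ∈-++⁺ʳ u (here refl)

cancel-∷ : ∀ (a : List A) {a′ m b b′} → m ∉ a → m ∉ a′ →
  a ++ m ∷ b ≡ a′ ++ m ∷ b′ → a ≡ a′ × b ≡ b′
cancel-∷ a {a′} m∉a m∉a′ eq with position a eq
... | before s refl _ = ⊥-elim (m∉a (∈-mid a′))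
... | at _ u≡a v≡b    = sym u≡a , sym v≡b
... | after s _ refl  = ⊥-elim (m∉a′ (∈-mid a))

unique-resp-↭ : ∀ {xs ys : List A} → xs ↭ ys → Unique xs → Unique ys
unique-resp-↭ {A = A} p = Permₛ.Unique-resp-↭ (setoid A) (↭⇒↭ₛ p)

unique-++ˡ : ∀ (a : List A) {b} → Unique (a ++ b) → Unique a
unique-++ˡ []      _       = []
unique-++ˡ (_ ∷ a) (h ∷ u) = All.++⁻ˡ a h ∷ unique-++ˡ a u

unique-++ʳ : ∀ (a : List A) {b} → Unique (a ++ b) → Unique b
unique-++ʳ []      u       = u
unique-++ʳ (_ ∷ a) (_ ∷ u) = unique-++ʳ a u

unique-mid : ∀ (u : List A) {i v} → Unique (u ++ i ∷ v) → i ∉ u × i ∉ v × Unique (u ++ v)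
unique-mid u {i} {v} un with unique-resp-↭ (shift i u v) un
... | i∉uv ∷ un′ = (λ i∈u → All.lookup i∉uv (∈-++⁺ˡ i∈u) refl)
                 , (λ i∈v → All.lookup i∉uv (∈-++⁺ʳ u i∈v) refl) , un′

unique-position : ∀ {w : List A} u {i v u′ v′} → Unique w →
  w ≡ u ++ i ∷ v → w ≡ u′ ++ i ∷ v′ → u ≡ u′ × v ≡ v′
unique-position u {u′ = u′} un refl eq =
  cancel-∷ u (proj₁ (unique-mid u un)) (proj₁ (unique-mid u′ (subst Unique eq un))) eq

⊎-cancelˡ : ∀ {P Q R : Set} → (P ⊎ Q) ⇔ (P ⊎ R) → (Q → ¬ P) → (R → ¬ P) → Q ⇔ R
⊎-cancelˡ e q⇒¬p r⇒¬p = mk⇔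
  (λ q → [ (λ p → ⊥-elim (q⇒¬p q p)) , (λ r → r) ]′ (Equivalence.to e (inj₂ q)))
  (λ r → [ (λ p → ⊥-elim (r⇒¬p r p)) , (λ q → q) ]′ (Equivalence.from e (inj₂ r)))

∈-∷⇔ : ∀ {i x : A} {xs} → i ∈ x ∷ xs ⇔ (i ≡ x ⊎ i ∈ xs)
∈-∷⇔ {i = i} = ⇔-sym (↔⇒⇔ (Any.∷↔ (i ≡_)))

∈-↭⇔ : ∀ {i : A} {xs ys} → xs ↭ ys → i ∈ xs ⇔ i ∈ ys
∈-↭⇔ p = mk⇔ (∈-resp-↭ p) (∈-resp-↭ (↭-sym p))

-- Letter statistics.  At P w i: the letter i occurs in w with a suffix
-- satisfying P.  RL-extrema and ascents/descents are instances.

At : (List ℤ → Set) → List ℤ → ℤ → Set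
At P w i = ∃[ u ] ∃[ v ] (w ≡ u ++ i ∷ v × P v)

at-prefix : ∀ a {P w i} → At P w i → At P (a ++ w) i
at-prefix a {w = w} (u , v , refl , p) = a ++ u , v , sym (++-assoc a u _) , p

-- RLExtremum white = RLMin and RLExtremum black = RLMax, definitionally.
RLExtremum : Colour → List ℤ → ℤ → Set
RLExtremum c w i = At (All (i <[ c ]_)) w i

Head : (ℤ → Set) → List ℤ → Set
Head P v = ∃[ j ] ∃[ v′ ] (v ≡ j ∷ v′ × P j)

Ends : Colour → List ℤ → Set
Ends white v = v ≡ []
Ends black v = ⊥

FollowedBy : Colour → ℤ → List ℤ → Set
FollowedBy c i v = Ends c v ⊎ Head (i <[ c ]_) v

-- Turn white = Ascent definitionally; Turn black is equivalent to Descent.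
Turn : Colour → List ℤ → ℤ → Set
Turn c w i = At (FollowedBy c i) w i

descent⇔turn : ∀ {w i} → Descent w i ⇔ Turn black w i
descent⇔turn = mk⇔ (λ (u , j , v , e , j<i) → u , j ∷ v , e , inj₂ (j , v , refl , j<i)) from
  where
  from : ∀ {w i} → Turn black w i → Descent w i
  from (u , _ , refl , inj₂ (j , v , refl , j<i)) = u , j , v , refl , j<i

turn-exclusive : ∀ c {w i} → Unique w → Turn c w i → Turn (opp c) w i → ⊥
turn-exclusive c un (u , v , e , f) (u′ , v′ , e′ , f′)
  with unique-position u un e e′
... | _ , refl = exclusive c f f′
  where
  exclusive : ∀ c {i v} → FollowedBy c i v → FollowedBy (opp c) i v → ⊥
  exclusive white (inj₁ refl) (inj₂ (_ , _ , () , _))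
  exclusive white (inj₂ (_ , _ , refl , p)) (inj₂ (_ , _ , refl , q)) = ℤ.<-asym p q
  exclusive black (inj₂ (_ , _ , () , _)) (inj₁ refl)
  exclusive black (inj₂ (_ , _ , refl , p)) (inj₂ (_ , _ , refl , q)) = ℤ.<-asym p q

rlmin-after : ∀ u {x v i} → x < i → RLMin (u ++ x ∷ v) i ⇔ RLMin v i
rlmin-after u {x} {v} {i} x<i = mk⇔ to (λ h → at-prefix u (at-prefix [ x ] h))
  where
  to : RLMin (u ++ x ∷ v) i → RLMin v i
  to (u′ , v′ , e , i<v′) with position u e
  ... | before s _ refl  = ⊥-elim (ℤ.<-asym x<i (All.lookup i<v′ (∈-mid s)))
  ... | at refl _ _      = ⊥-elim (ℤ.<-irrefl refl x<i)
  ... | after s refl _   = s , v′ , refl , i<v′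

shiftedRLMax-at-min : ∀ u {x v i} → Unique (u ++ x ∷ v) → All (x ≤_) (u ++ x ∷ v) →
  ShiftedRLMax (u ++ x ∷ v) i ⇔ RLMax u i
shiftedRLMax-at-min u {x} {v} {i} un x≤w = mk⇔ to (λ h → u , x , v , refl , x≤w , h)
  where
  to : ShiftedRLMax (u ++ x ∷ v) i → RLMax u i
  to (w₁ , m , w₂ , e , m≤w , h)
    with ℤ.≤-antisym (All.lookup m≤w (∈-mid u)) (All.lookup x≤w (subst (m ∈_) (sym e) (∈-mid w₁)))
  ... | refl = subst (λ z → RLMax z i) (sym (proj₁ (unique-position u un refl e))) h

concatMap-↭ : ∀ (f : A → List A′) {xs ys} → xs ↭ ys → concatMap f xs ↭ concatMap f ys
concatMap-↭ f Perm.refl        = ↭-refl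
concatMap-↭ f (Perm.prep t p)  = ++⁺ˡ (f t) (concatMap-↭ f p)
concatMap-↭ f (Perm.swap t u p) =
  ↭-trans (shifts (f t) (f u)) (++⁺ˡ (f u) (++⁺ˡ (f t) (concatMap-↭ f p)))
concatMap-↭ f (Perm.trans p q) = ↭-trans (concatMap-↭ f p) (concatMap-↭ f q)

labelsF-concatMap : ∀ ts → labelsF ts ≡ concatMap labelsT ts
labelsF-concatMap []       = refl
labelsF-concatMap (t ∷ ts) = cong (labelsT t ++_) (labelsF-concatMap ts)

verticesF-concatMap : ∀ ts → verticesF ts ≡ concatMap verticesT ts
verticesF-concatMap []       = refl
verticesF-concatMap (t ∷ ts) = cong (verticesT t ++_) (verticesF-concatMap ts)

labelsF-++ : ∀ F G → labelsF (F ++ G) ≡ labelsF F ++ labelsF G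
labelsF-++ F G = trans (labelsF-concatMap (F ++ G))
  (trans (concatMap-++ labelsT F G) (sym (cong₂ _++_ (labelsF-concatMap F) (labelsF-concatMap G))))

labelsF-↭ : ∀ {F G} → F ↭ G → labelsF F ↭ labelsF G
labelsF-↭ {F} {G} p = subst₂ _↭_ (sym (labelsF-concatMap F)) (sym (labelsF-concatMap G))
  (concatMap-↭ labelsT p)

verticesF-++ : ∀ F G → verticesF (F ++ G) ≡ verticesF F ++ verticesF G
verticesF-++ F G = trans (verticesF-concatMap (F ++ G))
  (trans (concatMap-++ verticesT F G) (sym (cong₂ _++_ (verticesF-concatMap F) (verticesF-concatMap G))))

verticesF-↭ : ∀ {F G} → F ↭ G → verticesF F ↭ verticesF G
verticesF-↭ {F} {G} p = subst₂ _↭_ (sym (verticesF-concatMap F)) (sym (verticesF-concatMap G))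
  (concatMap-↭ verticesT p)

mutual
  vertex-labelsT : ∀ t → map proj₂ (verticesT t) ≡ labelsT t
  vertex-labelsT (node c m ts) = cong (m ∷_) (vertex-labelsF ts)

  vertex-labelsF : ∀ ts → map proj₂ (verticesF ts) ≡ labelsF ts
  vertex-labelsF []       = refl
  vertex-labelsF (t ∷ ts) = trans (map-++ proj₂ (verticesT t) (verticesF ts))
                                  (cong₂ _++_ (vertex-labelsT t) (vertex-labelsF ts))

vertex-of-label : ∀ {i} F → i ∈ labelsF F → ∃[ c ] ((c , i) ∈ verticesF F)
vertex-of-label {i} F i∈F with ∈-map⁻ proj₂ (subst (i ∈_) (sym (vertex-labelsF F)) i∈F)
... | (c , .i) , v∈F , refl = c , v∈F

-- ψ lists the labels of a tree in post-order, so it rearranges them.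
mutual
  ψ-↭ : ∀ t → labelsT t ↭ ψ t
  ψ-↭ (node c m ts) = ↭-trans (↭-prep m (ψs-↭ ts)) (++-comm [ m ] (ψs ts))

  ψs-↭ : ∀ ts → labelsF ts ↭ ψs ts
  ψs-↭ []       = ↭-refl
  ψs-↭ (t ∷ ts) = ++⁺ (ψ-↭ t) (ψs-↭ ts)

ψs-node : ∀ c m cs ts → ψs (node c m cs ∷ ts) ≡ ψs cs ++ m ∷ ψs ts
ψs-node c m cs ts = ++-assoc (ψs cs) [ m ] (ψs ts)

∈-ψs : ∀ {y} ts → y ∈ ψs ts → y ∈ labelsF ts
∈-ψs ts = ∈-resp-↭ (↭-sym (ψs-↭ ts))

All-ψs : ∀ {P : ℤ → Set} ts → All P (labelsF ts) → All P (ψs ts)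
All-ψs ts = All-resp-↭ (ψs-↭ ts)

-- The first letter of ψ t is a label of t (it is the leftmost leaf).
ψ-head : ∀ t → Head (_∈ labelsT t) (ψ t)
ψ-head (node c m cs) with ψs cs in eq
... | []    = m , [] , refl , here refl
... | y ∷ r = y , r ++ [ m ] , refl , there (∈-ψs cs (subst (y ∈_) (sym eq) (here refl)))

followedBy-ψs : ∀ c {m b} ts → All (m <[ c ]_) (labelsF ts) → FollowedBy c m b →
  FollowedBy c m (ψs ts ++ b)
followedBy-ψs c []       _     f = f
followedBy-ψs c (t ∷ ts) m<ts _ with ψ-head t
... | j , r , e , j∈t = inj₂ (j , (r ++ ψs ts) ++ _ , cong (λ z → (z ++ ψs ts) ++ _) e ,
                              All.lookup (All.++⁻ˡ (labelsT t) m<ts) j∈t)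

-- The sorted black-rooted (white-rooted) part
-- of an alternative forest is a black (white) chain, and ψs is a bijection
-- from c-chains onto repetition-free words: the first root is the c-extremal
-- letter of the word, its subtrees encode the letters on its left, the later
-- trees those on its right.

data Chain : Colour → List Tree → Set where
  []   : ∀ {c} → Chain c []
  cons : ∀ {c m cs ts} → All (m <[ c ]_) (labelsF cs) → Chain (opp c) cs →
         All (m <[ c ]_) (labelsF ts) → Chain c ts → Chain c (node c m cs ∷ ts)

Root : Colour → List Tree → ℤ → Set
Root c F i = Any (λ t → colour t ≡ c × rootLabel t ≡ i) F

root-colour : ∀ {c d F i} → Chain c F → Root d F i → d ≡ c
root-colour (cons _ _ _ _)   (here (refl , _)) = refl
root-colour (cons _ _ _ cht) (there r)         = root-colour cht r

rootLabel-∈ : ∀ {t ts} → t ∈ ts → rootLabel t ∈ labelsF ts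
rootLabel-∈ {node _ _ _} (here refl)    = here refl
rootLabel-∈ {ts = u ∷ _}  (there t∈ts) = ∈-++⁺ʳ (labelsT u) (rootLabel-∈ t∈ts)

ψs-nonempty : ∀ t ts → ψs (t ∷ ts) ≢ []
ψs-nonempty t ts eq with ψ-head t
... | j , r , e , _ with trans (sym (cong (_++ ψs ts) e)) eq
...   | ()

root-extremal : ∀ c {m y} cs ts → All (m <[ c ]_) (labelsF cs) → All (m <[ c ]_) (labelsF ts) →
  y ∈ ψs cs ++ m ∷ ψs ts → m ≤[ c ] y
root-extremal c cs ts m<cs m<ts y∈w with ∈-++⁻ (ψs cs) y∈w
... | inj₁ y∈cs         = <[]⇒≤[] c (All.lookup (All-ψs cs m<cs) y∈cs)
... | inj₂ (here refl)  = ≤[]-refl c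
... | inj₂ (there y∈ts) = <[]⇒≤[] c (All.lookup (All-ψs ts m<ts) y∈ts)

∉-ψs : ∀ c {m} cs → All (m <[ c ]_) (labelsF cs) → m ∉ ψs cs
∉-ψs c cs m<cs m∈cs = <[]-irrefl c (All.lookup (All-ψs cs m<cs) m∈cs)

node-word-injective : ∀ c {m m′} cs ts cs′ ts′ →
  All (m <[ c ]_) (labelsF cs) → All (m <[ c ]_) (labelsF ts) →
  All (m′ <[ c ]_) (labelsF cs′) → All (m′ <[ c ]_) (labelsF ts′) →
  ψs cs ++ m ∷ ψs ts ≡ ψs cs′ ++ m′ ∷ ψs ts′ → m ≡ m′ × ψs cs ≡ ψs cs′ × ψs ts ≡ ψs ts′
node-word-injective c {m} {m′} cs ts cs′ ts′ m<cs m<ts m′<cs′ m′<ts′ e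
  with ≤[]-antisym c (root-extremal c cs ts m<cs m<ts (subst (m′ ∈_) (sym e) (∈-mid (ψs cs′))))
                     (root-extremal c cs′ ts′ m′<cs′ m′<ts′ (subst (m ∈_) e (∈-mid (ψs cs))))
... | refl = refl , cancel-∷ (ψs cs) (∉-ψs c cs m<cs) (∉-ψs c cs′ m′<cs′) e

ψs-injective : ∀ {c F G} → Chain c F → Chain c G → ψs F ≡ ψs G → F ≡ G
ψs-injective [] [] _ = refl
ψs-injective [] (cons {c} {m} {cs} {ts} _ _ _ _) e = ⊥-elim (ψs-nonempty (node c m cs) ts (sym e))
ψs-injective (cons {c} {m} {cs} {ts} _ _ _ _) [] e = ⊥-elim (ψs-nonempty (node c m cs) ts e)
ψs-injective {c} (cons {m = m} {cs} {ts} m<cs chc m<ts cht)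
                 (cons {m = m′} {cs′} {ts′} m′<cs′ chc′ m′<ts′ cht′) e
  with node-word-injective c cs ts cs′ ts′ m<cs m<ts m′<cs′ m′<ts′
         (trans (sym (ψs-node c m cs ts)) (trans e (ψs-node c m′ cs′ ts′)))
... | refl , ecs , ets =
  cong₂ (λ cs ts → node c m cs ∷ ts) (ψs-injective chc chc′ ecs) (ψs-injective cht cht′ ets)

chain-rigid : ∀ {c F G} → Chain c F → Chain c G → F ↭ G → F ≡ G
chain-rigid [] [] _ = refl
chain-rigid [] (cons _ _ _ _) p = ⊥-elim (¬x∷xs↭[] (↭-sym p))
chain-rigid (cons _ _ _ _) [] p = ⊥-elim (¬x∷xs↭[] p)
chain-rigid {c} (cons _ _ m<ts cht) (cons _ _ m′<ts′ cht′) p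
  with ∈-resp-↭ p (here refl) | ∈-resp-↭ (↭-sym p) (here refl)
... | here refl | _       = cong (_ ∷_) (chain-rigid cht cht′ (drop-∷ p))
... | there t∈ts′ | here e =
  ⊥-elim (<[]-irrefl c (subst (_<[ c ] _) (cong rootLabel e) (All.lookup m′<ts′ (rootLabel-∈ t∈ts′))))
... | there t∈ts′ | there t′∈ts =
  ⊥-elim (<[]-asym c (All.lookup m′<ts′ (rootLabel-∈ t∈ts′)) (All.lookup m<ts (rootLabel-∈ t′∈ts)))

-- Every repetition-free word is ψs of a c-chain: cut at the c-extremal letter m,
-- decode the left part as the (opp c)-chain below m and the right part as the
-- rest of the c-chain.

data ExtremalCut (c : Colour) : List ℤ → Set where
  cut : ∀ p m q → All (m ≤[ c ]_) (p ++ m ∷ q) → ExtremalCut c (p ++ m ∷ q)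

extremal-cut : ∀ c a v → ExtremalCut c (a ∷ v)
extremal-cut c a []      = cut [] a [] (≤[]-refl c ∷ [])
extremal-cut c a (b ∷ v) = extend (extremal-cut c b v)
  where
  extend : ∀ {w} → ExtremalCut c w → ExtremalCut c (a ∷ w)
  extend (cut p m q m≤w) with a ≤?[ c ] m
  ... | yes a≤m = cut [] a (p ++ m ∷ q) (≤[]-refl c ∷ All.map (≤[]-trans c a≤m) m≤w)
  ... | no  a≰m = cut (a ∷ p) m q (<[]⇒≤[] c (≰[]⇒>[] c a≰m) ∷ m≤w)

strictly : ∀ c {m xs} → All (m ≤[ c ]_) xs → m ∉ xs → All (m <[ c ]_) xs
strictly c m≤xs m∉xs =
  All.tabulate (λ y∈xs → ≤[]∧≢⇒<[] c (All.lookup m≤xs y∈xs) (λ { refl → m∉xs y∈xs }))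

_⊏_ : List ℤ → List ℤ → Set
u ⊏ w = length u ℕ.< length w

⊏-wellFounded : ∀ w → Acc _⊏_ w
⊏-wellFounded = on-wellFounded length <-wellFounded

left-⊏ : ∀ p {m : ℤ} q → p ⊏ (p ++ m ∷ q)
left-⊏ p q = subst (length p ℕ.<_) (sym (length-++ p)) (ℕ.m<m+n (length p) (ℕ.s≤s ℕ.z≤n))

right-⊏ : ∀ p {m : ℤ} q → q ⊏ (p ++ m ∷ q)
right-⊏ p q = subst (length q ℕ.<_) (sym (length-++ p)) (ℕ.m≤n+m (ℕ.suc (length q)) (length p))

mutual
  decompose : ∀ c w → Acc _⊏_ w → Unique w → ∃[ F ] (Chain c F × ψs F ≡ w)
  decompose c []      _  _  = [] , [] , refl
  decompose c (a ∷ v) ac un = decompose-cut c (extremal-cut c a v) ac un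

  decompose-cut : ∀ c {w} → ExtremalCut c w → Acc _⊏_ w → Unique w → ∃[ F ] (Chain c F × ψs F ≡ w)
  decompose-cut c (cut p m q m≤w) (acc rs) un with unique-mid p un
  ... | m∉p , m∉q , un′
    with decompose (opp c) p (rs (left-⊏ p q)) (unique-++ˡ p un′)
       | decompose c q (rs (right-⊏ p q)) (unique-++ʳ p un′)
  ...  | cs , chc , refl | ts , cht , refl =
    node c m cs ∷ ts ,
    cons (below cs (All.++⁻ˡ (ψs cs) m≤w) m∉p) chc (below ts (All.tail (All.++⁻ʳ (ψs cs) m≤w)) m∉q) cht ,
    ψs-node c m cs ts
    where
    below : ∀ ts → All (m ≤[ c ]_) (ψs ts) → m ∉ ψs ts → All (m <[ c ]_) (labelsF ts)
    below ts m≤ts m∉ts = All-resp-↭ (↭-sym (ψs-↭ ts)) (strictly c m≤ts m∉ts)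

-- Roots of a c-chain are exactly the c-RL-extrema of its word: a root is
-- c-before everything to its right, and any other letter is followed by the
-- root of its own tree, which is c-before it.
chain-roots : ∀ {c F i} → Chain c F → Root c F i ⇔ RLExtremum c (ψs F) i
chain-roots {c} {F} {i} ch = mk⇔ (to ch) (from ch)
  where
  to : ∀ {F} → Chain c F → Root c F i → RLExtremum c (ψs F) i
  to (cons {m = m} {cs} {ts} _ _ m<ts _) (here (_ , refl)) =
    ψs cs , ψs ts , ψs-node c m cs ts , All-ψs ts m<ts
  to (cons {m = m} {cs} _ _ _ cht) (there r) = at-prefix (ψs cs ++ [ m ]) (to cht r)

  from : ∀ {F} → Chain c F → RLExtremum c (ψs F) i → Root c F i
  from [] ([]    , _ , () , _)
  from [] (_ ∷ _ , _ , () , _)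
  from (cons {m = m} {cs} {ts} m<cs _ _ cht) (u , v , e , i<v)
    with position (ψs cs) (trans (sym (ψs-node c m cs ts)) e)
  ... | before s e₁ refl = ⊥-elim (<[]-asym c (All.lookup (All-ψs cs m<cs) (subst (i ∈_) (sym e₁) (∈-mid u)))
                                                (All.lookup i<v (∈-mid s)))
  ... | at refl _ _        = here (refl , refl)
  ... | after s e′ _       = there (from cht (s , v , e′ , i<v))

-- What may follow a c-chain in a word: the end of the word (white only) or a
-- letter that is c-after all its labels.
Guard : Colour → List Tree → List ℤ → Set
Guard c F b = Ends c b ⊎ Head (λ j → All (_<[ c ] j) (labelsF F)) b

guard-tail : ∀ {c t ts b} → Guard c (t ∷ ts) b → Guard c ts b
guard-tail         (inj₁ e)                 = inj₁ e
guard-tail {t = t} (inj₂ (j , v , e , F<j)) = inj₂ (j , v , e , All.++⁻ʳ (labelsT t) F<j)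

word-node : ∀ c m cs ts b → ψs (node c m cs ∷ ts) ++ b ≡ ψs cs ++ m ∷ ψs ts ++ b
word-node c m cs ts b = trans (cong (_++ b) (ψs-node c m cs ts)) (++-assoc (ψs cs) (m ∷ ψs ts) b)

-- The letter after a vertex m is
-- the first letter of its right siblings' subtrees, or else the guard letter.
chain-turns : ∀ {c F} → Chain c F → ∀ {d i} b → Guard c F b → (d , i) ∈ verticesF F →
  Turn d (ψs F ++ b) i
chain-turns {c} (cons {m = m} {cs} {ts} m<cs chc m<ts cht) b g (here refl) =
  ψs cs , ψs ts ++ b , word-node c m cs ts b , followedBy-ψs c ts m<ts (follows g)
  where
  follows : Guard c (node c m cs ∷ ts) b → FollowedBy c m b
  follows (inj₁ e)                  = inj₁ e
  follows (inj₂ (j , v , e , F<j)) = inj₂ (j , v , e , All.head F<j)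
chain-turns {c} (cons {m = m} {cs} {ts} m<cs chc m<ts cht) b g (there v∈F)
  with ∈-++⁻ (verticesF cs) v∈F
... | inj₁ v∈cs = subst (λ w → Turn _ w _) (sym (word-node c m cs ts b))
  (chain-turns chc (m ∷ ψs ts ++ b) (inj₂ (m , _ , refl , All.map (<[]-opp c) m<cs)) v∈cs)
... | inj₂ v∈ts = subst (λ w → Turn _ w _) (sym (++-assoc (ψs cs ++ [ m ]) (ψs ts) b))
  (at-prefix (ψs cs ++ [ m ]) (chain-turns cht b (guard-tail {t = node c m cs} {ts} g) v∈ts))

AltNode : Colour → ℤ → List Tree → Set
AltNode c m ts = All (m <[ c ]_) (labelsF ts) × All (λ t → colour t ≡ opp c) ts
               × Linked _<[ opp c ]_ (rootLabels ts) × AltF ts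

fromAltT : ∀ c {m ts} → AltT (node c m ts) → AltNode c m ts
fromAltT white a = a
fromAltT black a = a

toAltT : ∀ c {m ts} → AltNode c m ts → AltT (node c m ts)
toAltT white a = a
toAltT black a = a

AltF⇒All : ∀ {F} → AltF F → All AltT F
AltF⇒All {[]}    _       = []
AltF⇒All {_ ∷ _} (a , as) = a ∷ AltF⇒All as

All⇒AltF : ∀ {F} → All AltT F → AltF F
All⇒AltF []       = _
All⇒AltF (a ∷ as) = a , All⇒AltF as

chain-colour : ∀ {c F} → Chain c F → All (λ t → colour t ≡ c) F
chain-colour []               = []
chain-colour (cons _ _ _ cht) = refl ∷ chain-colour cht

chain-linked : ∀ {c F} → Chain c F → Linked _<[ c ]_ (rootLabels F)
chain-linked []                       = []
chain-linked (cons _ _ _ [])          = [-]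
chain-linked (cons _ _ m<ts (cons {c} {m′} {cs′} {ts′} m′<cs′ chc′ m′<ts′ cht′)) =
  All.head m<ts ∷ chain-linked (cons m′<cs′ chc′ m′<ts′ cht′)

chain-alt : ∀ {c F} → Chain c F → All AltT F
chain-alt []                           = []
chain-alt {c} (cons m<cs chc _ cht) =
  toAltT c (m<cs , chain-colour chc , chain-linked chc , All⇒AltF (chain-alt chc)) ∷ chain-alt cht

RootOrder : Colour → Tree → Tree → Set
RootOrder c t u = rootLabel t ≤[ c ] rootLabel u

tree-extremal : ∀ c t → colour t ≡ c → AltT t → All (rootLabel t ≤[ c ]_) (labelsT t)
tree-extremal c (node .c m cs) refl a = ≤[]-refl c ∷ All.map (<[]⇒≤[] c) (proj₁ (fromAltT c a))

later-labels : ∀ c {m ts} → All (λ u → colour u ≡ c) ts → All AltT ts →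
  All (λ u → m ≤[ c ] rootLabel u) ts → All (m ≤[ c ]_) (labelsF ts)
later-labels c []         []       []          = []
later-labels c {ts = u ∷ _} (cu ∷ cts) (a ∷ as) (m≤u ∷ m≤ts) =
  All.++⁺ (All.map (≤[]-trans c m≤u) (tree-extremal c u cu a)) (later-labels c cts as m≤ts)

sorted-head-least : ∀ c t {ts} → Linked (RootOrder c) (t ∷ ts) → All (RootOrder c t) ts
sorted-head-least c t [-]        = []
sorted-head-least c t (t≤u ∷ lk) = Linked⇒All (≤[]-trans c) {v = t} t≤u lk

linked-roots : ∀ c {ts} → Linked _<[ c ]_ (rootLabels ts) → Linked (RootOrder c) ts
linked-roots c {[]}         _          = []
linked-roots c {_ ∷ []}     _          = [-]
linked-roots c {_ ∷ _ ∷ _} (r ∷ lk) = <[]⇒≤[] c r ∷ linked-roots c lk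

alt-chain : ∀ c F → All (λ t → colour t ≡ c) F → All AltT F → Linked (RootOrder c) F →
  Unique (labelsF F) → Chain c F
alt-chain c []                   _          _        _  _                 = []
alt-chain c (node .c m cs ∷ ts) (refl ∷ cts) (a ∷ as) lk (m∉ ∷ un)
  with fromAltT c a
... | m<cs , ccs , lcs , acs =
  cons m<cs (alt-chain (opp c) cs ccs (AltF⇒All acs) (linked-roots (opp c) lcs) (unique-++ˡ (labelsF cs) un))
       (strictly c (later-labels c cts as (sorted-head-least c (node c m cs) lk))
                   (λ m∈ts → All.lookup m∉ (∈-++⁺ʳ (labelsF cs) m∈ts) refl))
       (alt-chain c ts cts as (Linked.tail lk) (unique-++ʳ (labelsF cs) un))

-- Sorting by root labels.  insertInc/insertDec are the two instances of one
-- insertion sort along the c-order.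

insertBy : Colour → Tree → List Tree → List Tree
insertBy c t []       = [ t ]
insertBy c t (u ∷ us) with rootLabel t ≤?[ c ] rootLabel u
... | yes _ = t ∷ u ∷ us
... | no  _ = u ∷ insertBy c t us

sortBy : Colour → List Tree → List Tree
sortBy c []       = []
sortBy c (t ∷ ts) = insertBy c t (sortBy c ts)

sortInc≡sortBy : ∀ ts → sortInc ts ≡ sortBy white ts
sortInc≡sortBy []       = refl
sortInc≡sortBy (t ∷ ts) = trans (insert (sortInc ts)) (cong (insertBy white t) (sortInc≡sortBy ts))
  where
  insert : ∀ us → insertInc t us ≡ insertBy white t us
  insert []       = refl
  insert (u ∷ us) with rootLabel t ≤? rootLabel u
  ... | yes _ = refl
  ... | no  _ = cong (u ∷_) (insert us)

sortDec≡sortBy : ∀ ts → sortDec ts ≡ sortBy black ts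
sortDec≡sortBy []       = refl
sortDec≡sortBy (t ∷ ts) = trans (insert (sortDec ts)) (cong (insertBy black t) (sortDec≡sortBy ts))
  where
  insert : ∀ us → insertDec t us ≡ insertBy black t us
  insert []       = refl
  insert (u ∷ us) with rootLabel u ≤? rootLabel t
  ... | yes _ = refl
  ... | no  _ = cong (u ∷_) (insert us)

sortBy-↭ : ∀ c ts → sortBy c ts ↭ ts
sortBy-↭ c []       = ↭-refl
sortBy-↭ c (t ∷ ts) = ↭-trans (insert (sortBy c ts)) (↭-prep t (sortBy-↭ c ts))
  where
  insert : ∀ us → insertBy c t us ↭ t ∷ us
  insert []       = ↭-refl
  insert (u ∷ us) with rootLabel t ≤?[ c ] rootLabel u
  ... | yes _ = ↭-refl
  ... | no  _ = ↭-trans (↭-prep u (insert us)) (↭-swap u t ↭-refl)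

sortBy-sorted : ∀ c ts → Linked (RootOrder c) (sortBy c ts)
sortBy-sorted c []       = []
sortBy-sorted c (t ∷ ts) = insert (sortBy c ts) (sortBy-sorted c ts)
  where
  insert-behind : ∀ a us → RootOrder c a t → Linked (RootOrder c) (a ∷ us) →
    Linked (RootOrder c) (a ∷ insertBy c t us)
  insert-behind a []       a≤t _          = a≤t ∷ [-]
  insert-behind a (u ∷ us) a≤t (a≤u ∷ lk) with rootLabel t ≤?[ c ] rootLabel u
  ... | yes t≤u = a≤t ∷ t≤u ∷ lk
  ... | no  t≰u = a≤u ∷ insert-behind u us (<[]⇒≤[] c (≰[]⇒>[] c t≰u)) lk

  insert : ∀ us → Linked (RootOrder c) us → Linked (RootOrder c) (insertBy c t us)
  insert []       _  = [-]
  insert (u ∷ us) lk with rootLabel t ≤?[ c ] rootLabel u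
  ... | yes t≤u = t≤u ∷ lk
  ... | no  t≰u = insert-behind u us (<[]⇒≤[] c (≰[]⇒>[] c t≰u)) lk

sortBy-chain : ∀ {c F} → Chain c F → Unique (labelsF F) → sortBy c F ≡ F
sortBy-chain {c} {F} ch un = chain-rigid sorted-chain ch (sortBy-↭ c F)
  where
  sorted-chain : Chain c (sortBy c F)
  sorted-chain = alt-chain c (sortBy c F)
    (All-resp-↭ (↭-sym (sortBy-↭ c F)) (chain-colour ch))
    (All-resp-↭ (↭-sym (sortBy-↭ c F)) (chain-alt ch))
    (sortBy-sorted c F)
    (unique-resp-↭ (labelsF-↭ (↭-sym (sortBy-↭ c F))) un)

hasColour? : ∀ c (t : Tree) → Dec (colour t ≡ c)
hasColour? c t = colour t ≟ᶜ c

rooted : Colour → List Tree → List Tree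
rooted c = filter (hasColour? c)

arrange : Colour → List Tree → List Tree
arrange c F = sortBy c (rooted c F)

whiteRooted≡rooted : ∀ F → whiteRooted F ≡ rooted white F
whiteRooted≡rooted []                    = refl
whiteRooted≡rooted (node white _ _ ∷ F) = cong (_ ∷_) (whiteRooted≡rooted F)
whiteRooted≡rooted (node black _ _ ∷ F) = whiteRooted≡rooted F

blackRooted≡rooted : ∀ F → blackRooted F ≡ rooted black F
blackRooted≡rooted []                    = refl
blackRooted≡rooted (node white _ _ ∷ F) = blackRooted≡rooted F
blackRooted≡rooted (node black _ _ ∷ F) = cong (_ ∷_) (blackRooted≡rooted F)

Ψ-arrange : ∀ x F → Ψ x F ≡ ψs (arrange black F) ++ x ∷ ψs (arrange white F)
Ψ-arrange x F = cong₂ (λ B W → ψs B ++ x ∷ ψs W)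
  (trans (sortDec≡sortBy (blackRooted F)) (cong (sortBy black) (blackRooted≡rooted F)))
  (trans (sortInc≡sortBy (whiteRooted F)) (cong (sortBy white) (whiteRooted≡rooted F)))

colour-split : ∀ F → F ↭ rooted black F ++ rooted white F
colour-split []                    = ↭-refl
colour-split (node white m ts ∷ F) =
  ↭-trans (↭-prep _ (colour-split F)) (↭-sym (shift _ (rooted black F) (rooted white F)))
colour-split (node black m ts ∷ F) = ↭-prep _ (colour-split F)

arrange-split : ∀ F → F ↭ arrange black F ++ arrange white F
arrange-split F = ↭-trans (colour-split F)
  (++⁺ (↭-sym (sortBy-↭ black (rooted black F))) (↭-sym (sortBy-↭ white (rooted white F))))

arrange-↭ : ∀ c {F G} → F ↭ G → arrange c F ↭ arrange c G
arrange-↭ c {F} {G} p = ↭-trans (sortBy-↭ c (rooted c F))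
  (↭-trans (filter-↭ (hasColour? c) p) (↭-sym (sortBy-↭ c (rooted c G))))

rooted-unique : ∀ c F → Unique (labelsF F) → Unique (labelsF (rooted c F))
rooted-unique c F un = side c (subst Unique (labelsF-++ (rooted black F) (rooted white F))
                                         (unique-resp-↭ (labelsF-↭ (colour-split F)) un))
  where
  side : ∀ c → Unique (labelsF (rooted black F) ++ labelsF (rooted white F)) → Unique (labelsF (rooted c F))
  side black = unique-++ˡ (labelsF (rooted black F))
  side white = unique-++ʳ (labelsF (rooted black F))

arrange-chain : ∀ c {F} → AltF F → Unique (labelsF F) → Chain c (arrange c F)
arrange-chain c {F} alt un = alt-chain c (arrange c F)
  (All-resp-↭ unsort (All.all-filter (hasColour? c) F))
  (All-resp-↭ unsort (All.filter⁺ (hasColour? c) (AltF⇒All alt)))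
  (sortBy-sorted c (rooted c F))
  (unique-resp-↭ (labelsF-↭ unsort) (rooted-unique c F un))
  where
  unsort : rooted c F ↭ arrange c F
  unsort = ↭-sym (sortBy-↭ c (rooted c F))

arrange-join : ∀ {B W} → Chain black B → Chain white W → Unique (labelsF B) → Unique (labelsF W) →
  arrange black (B ++ W) ≡ B × arrange white (B ++ W) ≡ W
arrange-join {B} {W} chB chW unB unW =
  (begin
    arrange black (B ++ W)                          ≡⟨ cong (sortBy black) (filter-++ (hasColour? black) B W) ⟩
    sortBy black (rooted black B ++ rooted black W) ≡⟨ cong₂ (λ B′ W′ → sortBy black (B′ ++ W′))
                                                             (same chB) (other chW) ⟩
    sortBy black (B ++ [])                          ≡⟨ cong (sortBy black) (++-identityʳ B) ⟩
    sortBy black B                                  ≡⟨ sortBy-chain chB unB ⟩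
    B                                               ∎) ,
  (begin
    arrange white (B ++ W)                          ≡⟨ cong (sortBy white) (filter-++ (hasColour? white) B W) ⟩
    sortBy white (rooted white B ++ rooted white W) ≡⟨ cong₂ (λ B′ W′ → sortBy white (B′ ++ W′))
                                                             (other chB) (same chW) ⟩
    sortBy white W                                  ≡⟨ sortBy-chain chW unW ⟩
    W                                               ∎)
  where
  open ≡-Reasoning
  same : ∀ {c F} → Chain c F → rooted c F ≡ F
  same {c} ch = filter-all (hasColour? c) (chain-colour ch)

  other : ∀ {c F} → Chain (opp c) F → rooted c F ≡ []
  other {c} ch = filter-none (hasColour? c)
    (All.map (λ is-opp is-c → opp-≢ c (trans (sym is-opp) is-c)) (chain-colour ch))

module Joined (x : ℤ) {B W : List Tree} (chB : Chain black B) (chW : Chain white W)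
  (x<B : All (x <_) (labelsF B)) (x<W : All (x <_) (labelsF W))
  (un : Unique (ψs B ++ x ∷ ψs W)) where

  σ : List ℤ
  σ = ψs B ++ x ∷ ψs W

  x-least : All (x ≤_) σ
  x-least = All.++⁺ (All.map ℤ.<⇒≤ (All-ψs B x<B)) (ℤ.≤-refl ∷ All.map ℤ.<⇒≤ (All-ψs W x<W))

  white-roots : ∀ {i} → x < i → Root white (B ++ W) i ⇔ RLMin σ i
  white-roots {i} x<i = ⇔-sym (rlmin-after (ψs B) x<i) ⇔-∘ (chain-roots chW ⇔-∘ only-W)
    where
    only-W : Root white (B ++ W) i ⇔ Root white W i
    only-W = mk⇔ (λ r → [ (λ rB → ⊥-elim (opp-≢ black (root-colour chB rB))) , (λ rW → rW) ]′
                           (Any.++⁻ B r))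
                 (Any.++⁺ʳ B)

  black-roots : ∀ {i} → Root black (B ++ W) i ⇔ ShiftedRLMax σ i
  black-roots {i} = ⇔-sym (shiftedRLMax-at-min (ψs B) un x-least) ⇔-∘ (chain-roots chB ⇔-∘ only-B)
    where
    only-B : Root black (B ++ W) i ⇔ Root black B i
    only-B = mk⇔ (λ r → [ (λ rB → rB) , (λ rW → ⊥-elim (opp-≢ white (root-colour chW rW))) ]′
                           (Any.++⁻ B r))
                 Any.++⁺ˡ

  -- B is followed by the letter x, below all its labels; W ends the word.
  turns : ∀ {c i} → (c , i) ∈ verticesF (B ++ W) → Turn c σ i
  turns {c} {i} v with ∈-++⁻ (verticesF B) (subst ((c , i) ∈_) (verticesF-++ B W) v)
  ... | inj₁ v∈B = chain-turns chB (x ∷ ψs W) (inj₂ (x , ψs W , refl , x<B)) v∈B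
  ... | inj₂ v∈W = at-prefix (ψs B) (at-prefix [ x ]
                     (subst (λ w → Turn c w i) (++-identityʳ (ψs W)) (chain-turns chW [] (inj₁ refl) v∈W)))

  -- Every label carries a vertex of one colour, and ascents exclude descents.
  vertices : ∀ c {i} → i ∈ labelsF (B ++ W) → ((c , i) ∈ verticesF (B ++ W)) ⇔ Turn c σ i
  vertices c {i} i∈BW = mk⇔ turns from
    where
    from : Turn c σ i → (c , i) ∈ verticesF (B ++ W)
    from t with vertex-of-label (B ++ W) i∈BW
    ... | d , v with d ≟ᶜ c
    ...   | yes refl = v
    ...   | no  d≢c  = ⊥-elim (turn-exclusive c un t (subst (λ d → Turn d σ i) (other-colour d≢c) (turns v)))

module Arranged {L : List ℤ} {x : ℤ} (x<L : All (x <_) L) {F : List Tree} (pf : PAForest L F) where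

  open Equivalence

  labels-L : ∀ i → i ∈ labelsF F ⇔ i ∈ L
  labels-L = proj₂ (proj₂ pf)

  B W : List Tree
  B = arrange black F
  W = arrange white F

  chB : Chain black B
  chB = arrange-chain black (proj₁ pf) (proj₁ (proj₂ pf))

  chW : Chain white W
  chW = arrange-chain white (proj₁ pf) (proj₁ (proj₂ pf))

  split : F ↭ B ++ W
  split = arrange-split F

  x<F : All (x <_) (labelsF F)
  x<F = All.tabulate (λ i∈F → All.lookup x<L (to (labels-L _) i∈F))

  x<BW : All (x <_) (labelsF B ++ labelsF W)
  x<BW = subst (All (x <_)) (labelsF-++ B W) (All-resp-↭ (labelsF-↭ split) x<F)

  σ-↭ : ψs B ++ x ∷ ψs W ↭ x ∷ labelsF F
  σ-↭ = ↭-trans (shift x (ψs B) (ψs W)) (↭-prep x (↭-trans (↭-sym (++⁺ (ψs-↭ B) (ψs-↭ W)))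
          (↭-trans (↭-reflexive (sym (labelsF-++ B W))) (labelsF-↭ (↭-sym split)))))

  σ-unique : Unique (ψs B ++ x ∷ ψs W)
  σ-unique = unique-resp-↭ (↭-sym σ-↭)
    (All.map (λ x<i x≡i → ℤ.<-irrefl x≡i x<i) x<F ∷ proj₁ (proj₂ pf))

  x∉B : x ∉ ψs B
  x∉B = proj₁ (unique-mid (ψs B) σ-unique)

  Ψ≡σ : Ψ x F ≡ ψs B ++ x ∷ ψs W
  Ψ≡σ = Ψ-arrange x F

  open Joined x chB chW (All.++⁻ˡ (labelsF B) x<BW) (All.++⁻ʳ (labelsF B) x<BW) σ-unique public

Ψ-permutation : ∀ {L x} → All (x <_) L → ∀ F → PAForest L F → PermOn x L (Ψ x F)
Ψ-permutation {L} {x} x<L F pf = subst (PermOn x L) (sym Ψ≡σ) (σ-unique , support)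
  where
  open Arranged x<L pf
  support : ∀ i → i ∈ σ ⇔ (i ≡ x ⊎ i ∈ L)
  support i = (⇔-id _ ⊎-⇔ labels-L i) ⇔-∘ (∈-∷⇔ ⇔-∘ ∈-↭⇔ σ-↭)

Ψ-respects-↭ : ∀ {L x} → All (x <_) L → ∀ F G → PAForest L F → PAForest L G → F ↭ G → Ψ x F ≡ Ψ x G
Ψ-respects-↭ {x = x} x<L F G pf pg p = begin
  Ψ x F                    ≡⟨ AF.Ψ≡σ ⟩
  ψs AF.B ++ x ∷ ψs AF.W   ≡⟨ cong₂ (λ B W → ψs B ++ x ∷ ψs W)
                                    (chain-rigid AF.chB AG.chB (arrange-↭ black p))
                                    (chain-rigid AF.chW AG.chW (arrange-↭ white p)) ⟩
  ψs AG.B ++ x ∷ ψs AG.W   ≡⟨ sym AG.Ψ≡σ ⟩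
  Ψ x G                    ∎
  where
  open ≡-Reasoning
  module AF = Arranged x<L pf
  module AG = Arranged x<L pg

Ψ-injective : ∀ {L x} → All (x <_) L → ∀ F G → PAForest L F → PAForest L G → Ψ x F ≡ Ψ x G → F ↭ G
Ψ-injective x<L F G pf pg e =
  ↭-trans AF.split (↭-trans (↭-reflexive (cong₂ _++_ (ψs-injective AF.chB AG.chB (proj₁ x-cut))
                                                     (ψs-injective AF.chW AG.chW (proj₂ x-cut))))
                            (↭-sym AG.split))
  where
  module AF = Arranged x<L pf
  module AG = Arranged x<L pg
  -- x occurs once in each word, so it cuts both at the same place
  x-cut : ψs AF.B ≡ ψs AG.B × ψs AF.W ≡ ψs AG.W
  x-cut = cancel-∷ (ψs AF.B) AF.x∉B AG.x∉B (trans (sym AF.Ψ≡σ) (trans e AG.Ψ≡σ))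

-- Cut w at x; the part on the left decodes to a black chain, the part on the
-- right to a white chain, and together they form the preimage forest.
Ψ-surjective : ∀ {L x} → All (x <_) L → ∀ w → PermOn x L w → ∃[ F ] (PAForest L F × Ψ x F ≡ w)
Ψ-surjective {L} {x} x<L w (un-w , support) with ∈-∃++ (Equivalence.from (support x) (inj₁ refl))
... | u , v , refl with unique-mid u un-w
...   | x∉u , x∉v , un-uv
  with decompose black u (⊏-wellFounded u) (unique-++ˡ u un-uv)
     | decompose white v (⊏-wellFounded v) (unique-++ʳ u un-uv)
...   | B , chB , refl | W , chW , refl = B ++ W , (alt , unique , labels) , Ψ≡w
  where
  labels-↭ : labelsF (B ++ W) ↭ ψs B ++ ψs W
  labels-↭ = ↭-trans (↭-reflexive (labelsF-++ B W)) (++⁺ (ψs-↭ B) (ψs-↭ W))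

  alt : AltF (B ++ W)
  alt = All⇒AltF (All.++⁺ (chain-alt chB) (chain-alt chW))

  unique : Unique (labelsF (B ++ W))
  unique = unique-resp-↭ (↭-sym labels-↭) un-uv

  labels : ∀ i → i ∈ labelsF (B ++ W) ⇔ i ∈ L
  labels i = ⊎-cancelˡ (support i ⇔-∘ ⇔-sym (∈-∷⇔ ⇔-∘ ∈-↭⇔ (shift x (ψs B) (ψs W))))
               (λ { i∈uv refl → [ x∉u , x∉v ]′ (∈-++⁻ (ψs B) i∈uv) })
               (λ { i∈L refl → ℤ.<-irrefl refl (All.lookup x<L i∈L) })
             ⇔-∘ ∈-↭⇔ labels-↭

  Ψ≡w : Ψ x (B ++ W) ≡ ψs B ++ x ∷ ψs W
  Ψ≡w with arrange-join chB chW (unique-resp-↭ (↭-sym (ψs-↭ B)) (unique-++ˡ (ψs B) un-uv))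
                                (unique-resp-↭ (↭-sym (ψs-↭ W)) (unique-++ʳ (ψs B) un-uv))
  ... | eB , eW = trans (Ψ-arrange x (B ++ W)) (cong₂ (λ B′ W′ → ψs B′ ++ x ∷ ψs W′) eB eW)

Ψ-statistics : ∀ {L x} → All (x <_) L → ∀ F → PAForest L F → ∀ i → i ∈ L →
  (WhiteRoot F i ⇔ RLMin (Ψ x F) i) × (BlackRoot F i ⇔ ShiftedRLMax (Ψ x F) i)
  × (WhiteVertex F i ⇔ Ascent (Ψ x F) i) × (BlackVertex F i ⇔ Descent (Ψ x F) i)
Ψ-statistics {x = x} x<L F pf i i∈L =
  subst (λ w → (WhiteRoot F i ⇔ RLMin w i) × (BlackRoot F i ⇔ ShiftedRLMax w i)
             × (WhiteVertex F i ⇔ Ascent w i) × (BlackVertex F i ⇔ Descent w i)) (sym Ψ≡σ)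
    ( white-roots (All.lookup x<L i∈L) ⇔-∘ roots-↭ white
    , black-roots ⇔-∘ roots-↭ black
    , vertices white i∈BW ⇔-∘ ∈-↭⇔ (verticesF-↭ split)
    , ⇔-sym descent⇔turn ⇔-∘ (vertices black i∈BW ⇔-∘ ∈-↭⇔ (verticesF-↭ split)))
  where
  open Arranged x<L pf
  roots-↭ : ∀ c → Root c F i ⇔ Root c (B ++ W) i
  roots-↭ c = mk⇔ (Any-resp-↭ split) (Any-resp-↭ (↭-sym split))
  i∈BW : i ∈ labelsF (B ++ W)
  i∈BW = ∈-resp-↭ (labelsF-↭ split) (Equivalence.from (labels-L i) i∈L)

proposition5p3 : (L : List ℤ) (x : ℤ) → All (λ y → x < y) L →
    (∀ F → PAForest L F → PermOn x L (Ψ x F))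
    × (∀ F G → PAForest L F → PAForest L G → F ↭ G → Ψ x F ≡ Ψ x G)
    × (∀ F G → PAForest L F → PAForest L G → Ψ x F ≡ Ψ x G → F ↭ G)
    × (∀ w → PermOn x L w → ∃[ F ] (PAForest L F × Ψ x F ≡ w))
    × (∀ F → PAForest L F → ∀ i → i ∈ L →
         (WhiteRoot F i ⇔ RLMin (Ψ x F) i)
         × (BlackRoot F i ⇔ ShiftedRLMax (Ψ x F) i)
         × (WhiteVertex F i ⇔ Ascent (Ψ x F) i)
         × (BlackVertex F i ⇔ Descent (Ψ x F) i))
proposition5p3 L x x<L =
  Ψ-permutation x<L , Ψ-respects-↭ x<L , Ψ-injective x<L , Ψ-surjective x<L , Ψ-statistics x<L
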